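{- For dynamic queues, no deterministic memoryless online algorithm has competitive ratio smaller than $2$.
   Context: Dynamic set problem: each item $x$ has a weight $w_x\ge 0$; time proceeds in steps; before each step items may be inserted into or deleted from a dynamic set $\mathcal{S}$; an item is active if inserted and not yet deleted; at each step an algorithm may collect at most one active item it has not collected before (pending items); the gain is the total weight collected. A deterministic online algorithm is $R$-competitive if on every instance its gain is at least $\mathrm{OPT}/R$ ($\mathrm{OPT}$ = maximum achievable gain); the competitive ratio is the infimum of such $R$. Dynamic queue: $\mathcal{S}$ is a linearly ordered list; items may be inserted at any position, but only a prefix of the current list may be deleted. An algorithm is memoryless if its decision of which item to collect depends only on the weights of its currently pending items (listed in queue order).
   Formalization: The weights $w_x$ and the ratio $R$ are taken in ℚ, so memoryless algorithms act on lists of rational weights. -}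

module Defs where

open import Data.Nat using (ℕ; zero; suc)
open import Data.Nat.Base using (_≡ᵇ_)
open import Data.Bool using (Bool; true; false; if_then_else_; _∨_)
open import Data.Fin using (Fin; cast)
open import Data.List using (List; []; _∷_; length; map; drop; lookup)
open import Data.List.Properties using (length-map)
open import Data.List.Relation.Unary.All using (All)
open import Data.Maybe using (Maybe; just; nothing)
open import Data.Product using (_×_; _,_; proj₁; proj₂)
open import Data.Rational using (ℚ; 0ℚ; _+_; _*_; _≤_)

-- An item: (identifier , weight).  Identifiers are assigned by insertion order.
Item : Set
Item = ℕ × ℚ

data Op : Set where
  ins : ℕ → ℚ → Op
                     -- (positions beyond the end of the list mean: at the end)
  del : ℕ → Op       -- delete the prefix of the given length (whole list if longer)

-- An instance: for each time step, the list of operations performed before it.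
Instance : Set
Instance = List (List Op)

OpNonNeg : Op → Set
OpNonNeg (ins _ w) = 0ℚ ≤ w
OpNonNeg (del _)   = 0ℚ ≤ 0ℚ

NonNeg : Instance → Set
NonNeg I = All (All OpNonNeg) I

insertPos : ℕ → Item → List Item → List Item
insertPos zero    x xs       = x ∷ xs
insertPos (suc i) x []       = x ∷ []
insertPos (suc i) x (y ∷ ys) = y ∷ insertPos i x ys

memb : ℕ → List ℕ → Bool
memb n []       = false
memb n (m ∷ ms) = (n ≡ᵇ m) ∨ memb n ms

pending : List ℕ → List Item → List Item
pending c []       = []
pending c (x ∷ xs) = if memb (proj₁ x) c then pending c xs else x ∷ pending c xs

-- A (general, possibly offline) collection strategy: at step t, given the list of
-- pending items in queue order, collect at most one of them.
Strategy : Set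
Strategy = ℕ → (pend : List Item) → Maybe (Fin (length pend))

Memoryless : Set
Memoryless = (ws : List ℚ) → Maybe (Fin (length ws))

memorylessStrategy : Memoryless → Strategy
memorylessStrategy A t pend with A (map proj₂ pend)
... | nothing = nothing
... | just j  = just (cast (length-map proj₂ pend) j)

record State : Set where
  constructor st
  field
    queue     : List Item
    nextId    : ℕ
    collected : List ℕ
    gain      : ℚ

applyOp : State → Op → State
applyOp (st q n c g) (ins i w) = st (insertPos i (n , w) q) (suc n) c g
applyOp (st q n c g) (del k)   = st (drop k q) n c g

applyOps : State → List Op → State
applyOps s []       = s
applyOps s (o ∷ os) = applyOps (applyOp s o) os

collect : Strategy → ℕ → State → State
collect S t (st q n c g) with S t (pending c q)
... | nothing = st q n c g
... | just j  = st q n (proj₁ x ∷ c) (g + proj₂ x)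
  where x = lookup (pending c q) j

runFrom : Strategy → ℕ → State → Instance → State
runFrom S t s []         = s
runFrom S t s (os ∷ I)   = runFrom S (suc t) (collect S t (applyOps s os)) I

gainOf : Strategy → Instance → ℚ
gainOf S I = State.gain (runFrom S 0 (st [] 0 [] 0ℚ) I)

-- A is R-competitive: on every instance, gain(A) ≥ OPT / R, i.e. every achievable
-- gain (OPT is the maximum of these) is at most R * gain(A).
Competitive : ℚ → Memoryless → Set
Competitive R A = (I : Instance) → NonNeg I → (S : Strategy) →
  gainOf S I ≤ R * gainOf (memorylessStrategy A) I

module Submission where

-- Let k be the denominator of R < 2, so that R ≤ (2k − 1)/k, and offer the weights k, k+1, …, 2k
-- in one step. If the algorithm collects nothing, or the lightest item k, a single collection of 2k
-- already beats it by a factor above R. Otherwise it collects some x whose left neighbour is q = x − 1.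
-- Now repeat: every further step deletes the prefix up to q and reinserts a fresh copy of everything up
-- to x in front. Having collected the old x's, the memoryless algorithm sees the same weights again
-- and collects the fresh x, while an offline strategy collects q each time and sweeps up the stale
-- copies of x at the end. After r rounds the gains are (r+1)(2x − 1) against at most (r+1)x plus the
-- total weight behind x, a ratio that exceeds (2k − 1)/k for large r because x > k.

open import Defs
open import Data.Bool using (true; false; T; if_then_else_)
open import Data.Bool.Properties using (T-≡; ∨-zeroʳ; ∨-identityʳ)
open import Data.Fin as Fin using (Fin; toℕ; cast)
import Data.Fin.Properties as Fin
open import Data.Integer as ℤ using (+_)
import Data.Integer.Properties as ℤ
open import Data.List using (List; []; _∷_; _++_; length; map; drop; lookup; replicate)
import Data.List.Properties as List
open import Data.List.Membership.Propositional.Properties using (∈-lookup)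
open import Data.List.Relation.Unary.All as All using (All; []; _∷_)
open import Data.List.Relation.Unary.All.Properties using (++⁺; replicate⁺; map⁺)
open import Data.List.Relation.Unary.AllPairs using (AllPairs; []; _∷_)
open import Data.Maybe as Maybe using (Maybe; just; nothing)
open import Data.Nat as ℕ using (ℕ; zero; suc; _∸_; _≡ᵇ_; _<ᵇ_)
import Data.Nat.Properties as ℕ
import Data.Nat.Coprimality as Coprime
open import Data.Nat.ListAction using (sum)
open import Data.Nat.Tactic.RingSolver using (solve-∀)
open import Algebra.Properties.CommutativeSemigroup ℕ.+-commutativeSemigroup using (x∙yz≈y∙xz)
open import Data.Product using (_×_; _,_; proj₁; proj₂; ∃-syntax)
open import Data.Rational using (ℚ; mkℚ; 0ℚ; 1ℚ; _+_; _*_; _<_; _≤_; _/_; ↥_; ↧ₙ_; *≤*)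
import Data.Rational.Properties as ℚ
import Data.Rational.Unnormalised.Properties as ℚᵘ
open import Function using (_∘_)
open import Function.Bundles using (Equivalence)
open import Relation.Binary.PropositionalEquality
open import Relation.Nullary using (¬_; contradiction)

fromℕ : ℕ → ℚ
fromℕ n = mkℚ (+ n) 0 (Coprime.sym (Coprime.1-coprimeTo n))

fromℕ-+ : ∀ m n → fromℕ m + fromℕ n ≡ fromℕ (m ℕ.+ n)
fromℕ-+ m n = trans (cong (_/ 1) numerator) (ℚ.↥p/↧p≡p (fromℕ (m ℕ.+ n)))
  where
  numerator : + m ℤ.* + 1 ℤ.+ + n ℤ.* + 1 ≡ + (m ℕ.+ n)
  numerator = trans (cong₂ ℤ._+_ (ℤ.*-identityʳ (+ m)) (ℤ.*-identityʳ (+ n))) (sym (ℤ.pos-+ m n))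

fromℕ-nonNeg : ∀ n → 0ℚ ≤ fromℕ n
fromℕ-nonNeg n = *≤* (subst (+ 0 ℤ.≤_) (sym (ℤ.*-identityʳ (+ n))) (ℤ.+≤+ ℕ.z≤n))

fromℕ-suc≰0 : ∀ n → ¬ (fromℕ (suc n) ≤ 0ℚ)
fromℕ-suc≰0 n h with ℚ.drop-*≤* h
... | ℤ.+≤+ ()

↥<2↧ : ∀ R → R < 1ℚ + 1ℚ → ↥ R ℤ.≤ + (2 ℕ.* ↧ₙ R ∸ 1)
↥<2↧ R R<2 = ℤ.i<j⇒i≤pred[j] (subst₂ ℤ._<_ (ℤ.*-identityʳ (↥ R)) (sym (ℤ.pos-* 2 (↧ₙ R))) cross)
  where
  cross : ↥ R ℤ.* + 1 ℤ.< + 2 ℤ.* + ↧ₙ R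
  cross = ℚ.drop-*<* R<2

fromℕ-≤-*-fromℕ : ∀ R s g → fromℕ s ≤ R * fromℕ g → + (↧ₙ R ℕ.* s) ℤ.≤ ↥ R ℤ.* + g
fromℕ-≤-*-fromℕ R@record{} s g h = subst₂ ℤ._≤_ lhs (ℤ.*-identityʳ (↥ R ℤ.* + g)) cross
  where
  k = ↧ₙ R
  lhs : + s ℤ.* (+ k ℤ.* + 1) ≡ + (k ℕ.* s)
  lhs = trans (cong (+ s ℤ.*_) (ℤ.*-identityʳ (+ k))) (trans (sym (ℤ.pos-* s k)) (cong +_ (ℕ.*-comm s k)))
  cross : + s ℤ.* (+ k ℤ.* + 1) ℤ.≤ (↥ R ℤ.* + g) ℤ.* + 1
  cross = ℚᵘ.drop-*≤* (ℚᵘ.≤-respʳ-≃ (ℚ.toℚᵘ-homo-* R (fromℕ g)) (ℚ.toℚᵘ-mono-≤ h))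

-- A ratio R < 2 with denominator k is at most (2k − 1)/k.
fromℕ≰*fromℕ : ∀ R → R < 1ℚ + 1ℚ → ∀ s g → (2 ℕ.* ↧ₙ R ∸ 1) ℕ.* g ℕ.< ↧ₙ R ℕ.* s →
               ¬ (fromℕ s ≤ R * fromℕ g)
fromℕ≰*fromℕ R R<2 s g ratio h = ℕ.<⇒≱ ratio (ℤ.drop‿+≤+ (ℤ.≤-trans (fromℕ-≤-*-fromℕ R s g h) bound))
  where
  bound : ↥ R ℤ.* + g ℤ.≤ + ((2 ℕ.* ↧ₙ R ∸ 1) ℕ.* g)
  bound = subst (↥ R ℤ.* + g ℤ.≤_) (sym (ℤ.pos-* (2 ℕ.* ↧ₙ R ∸ 1) g)) (ℤ.*-monoʳ-≤-nonNeg (+ g) (↥<2↧ R R<2))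

accumulate : ∀ k v G → k ℕ.* v ℕ.+ (G ℕ.+ v) ≡ suc k ℕ.* v ℕ.+ G
accumulate = solve-∀

rounds-total : ∀ k u v → suc k ℕ.* v ℕ.+ (k ℕ.* u ℕ.+ u) ≡ suc k ℕ.* (u ℕ.+ v)
rounds-total = solve-∀

-- Running r = D·C rounds absorbs the extra gain C of the online algorithm.
amplify : ∀ D k x y C G → D ℕ.* x ℕ.< k ℕ.* y → G ℕ.≤ suc (D ℕ.* C) ℕ.* x ℕ.+ C →
          D ℕ.* G ℕ.< k ℕ.* (suc (D ℕ.* C) ℕ.* y)
amplify D k x y C G Dx<ky G≤ = begin-strict
  D ℕ.* G                          ≤⟨ ℕ.*-monoʳ-≤ D G≤ ⟩
  D ℕ.* (suc r ℕ.* x ℕ.+ C)        ≡⟨ distribute D (suc r) x C ⟩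
  suc r ℕ.* (D ℕ.* x) ℕ.+ r        <⟨ ℕ.+-monoʳ-< (suc r ℕ.* (D ℕ.* x)) (ℕ.n<1+n r) ⟩
  suc r ℕ.* (D ℕ.* x) ℕ.+ suc r    ≡⟨ ℕ.+-comm (suc r ℕ.* (D ℕ.* x)) (suc r) ⟩
  suc r ℕ.+ suc r ℕ.* (D ℕ.* x)    ≡⟨ ℕ.*-suc (suc r) (D ℕ.* x) ⟨
  suc r ℕ.* suc (D ℕ.* x)          ≤⟨ ℕ.*-monoʳ-≤ (suc r) Dx<ky ⟩
  suc r ℕ.* (k ℕ.* y)              ≡⟨ ℕ.*-comm (suc r) (k ℕ.* y) ⟩
  k ℕ.* y ℕ.* suc r                ≡⟨ ℕ.*-assoc k y (suc r) ⟩
  k ℕ.* (y ℕ.* suc r)              ≡⟨ cong (k ℕ.*_) (ℕ.*-comm y (suc r)) ⟩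
  k ℕ.* (suc r ℕ.* y)              ∎
  where
  open ℕ.≤-Reasoning
  r = D ℕ.* C
  distribute : ∀ a b c d → a ℕ.* (b ℕ.* c ℕ.+ d) ≡ b ℕ.* (a ℕ.* c) ℕ.+ a ℕ.* d
  distribute = solve-∀

T⇒≡true : ∀ {b} → T b → b ≡ true
T⇒≡true = Equivalence.to T-≡

¬T⇒≡false : ∀ {b} → ¬ T b → b ≡ false
¬T⇒≡false {false} _  = refl
¬T⇒≡false {true}  ¬t = contradiction _ ¬t

≡ᵇ-refl : ∀ n → (n ≡ᵇ n) ≡ true
≡ᵇ-refl n = T⇒≡true (ℕ.≡⇒≡ᵇ n n refl)

≢⇒≡ᵇ≡false : ∀ {m n} → m ≢ n → (m ≡ᵇ n) ≡ false
≢⇒≡ᵇ≡false {m} {n} m≢n = ¬T⇒≡false (m≢n ∘ ℕ.≡ᵇ⇒≡ m n)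

<⇒<ᵇ≡true : ∀ {m n} → m ℕ.< n → (m <ᵇ n) ≡ true
<⇒<ᵇ≡true m<n = T⇒≡true (ℕ.<⇒<ᵇ m<n)

≥⇒<ᵇ≡false : ∀ {m n} → n ℕ.≤ m → (m <ᵇ n) ≡ false
≥⇒<ᵇ≡false {m} {n} n≤m = ¬T⇒≡false (ℕ.≤⇒≯ n≤m ∘ ℕ.<ᵇ⇒< m n)

memb-here : ∀ n c → memb n (n ∷ c) ≡ true
memb-here n c rewrite ≡ᵇ-refl n = refl

memb-there : ∀ {n} m c → memb n c ≡ true → memb n (m ∷ c) ≡ true
memb-there {n} m c e rewrite e = ∨-zeroʳ (n ≡ᵇ m)

memb-∷-false : ∀ {n m} c → n ≢ m → memb n c ≡ false → memb n (m ∷ c) ≡ false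
memb-∷-false c n≢m e rewrite ≢⇒≡ᵇ≡false n≢m | e = refl

all<⇒memb≡false : ∀ {n} c → All (ℕ._< n) c → memb n c ≡ false
all<⇒memb≡false []      []           = refl
all<⇒memb≡false (m ∷ c) (m<n ∷ m<ns) = memb-∷-false c (ℕ.>⇒≢ m<n) (all<⇒memb≡false c m<ns)

all>⇒memb≡false : ∀ {n} c → All (n ℕ.<_) c → memb n c ≡ false
all>⇒memb≡false []      []           = refl
all>⇒memb≡false (m ∷ c) (n<m ∷ n<ms) = memb-∷-false c (ℕ.<⇒≢ n<m) (all>⇒memb≡false c n<ms)

memb-self : ∀ is → All (λ i → memb i is ≡ true) is
memb-self []       = []
memb-self (i ∷ is) = memb-here i is ∷ All.map (memb-there i is) (memb-self is)

Collected Uncollected : List ℕ → Item → Set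
Collected   c it = memb (proj₁ it) c ≡ true
Uncollected c it = memb (proj₁ it) c ≡ false

IdBelow : ℕ → Item → Set
IdBelow n it = proj₁ it ℕ.< n

uncollected-∷ : ∀ {i} c {xs} → All (IdBelow i) xs → All (Uncollected c) xs → All (Uncollected (i ∷ c)) xs
uncollected-∷ c []           []       = []
uncollected-∷ c (p<i ∷ p<is) (u ∷ us) = memb-∷-false c (ℕ.<⇒≢ p<i) u ∷ uncollected-∷ c p<is us

uncollected-below : ∀ {m} c {xs} → All (m ℕ.≤_) c → All (IdBelow m) xs → All (Uncollected c) xs
uncollected-below c m≤c xs<m = All.map (λ i<m → all>⇒memb≡false c (All.map (ℕ.<-≤-trans i<m) m≤c)) xs<m

pending-++ : ∀ c xs ys → pending c (xs ++ ys) ≡ pending c xs ++ pending c ys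
pending-++ c []       ys = refl
pending-++ c (x ∷ xs) ys with memb (proj₁ x) c
... | true  = pending-++ c xs ys
... | false = cong (x ∷_) (pending-++ c xs ys)

pending-uncollected : ∀ c xs → All (Uncollected c) xs → pending c xs ≡ xs
pending-uncollected c []       []       = refl
pending-uncollected c (x ∷ xs) (u ∷ us) rewrite u = cong (x ∷_) (pending-uncollected c xs us)

pending-collected : ∀ c xs → All (Collected c) xs → pending c xs ≡ []
pending-collected c []       []       = refl
pending-collected c (x ∷ xs) (p ∷ ps) rewrite p = pending-collected c xs ps

pending-[] : ∀ xs → pending [] xs ≡ xs
pending-[] xs = pending-uncollected [] xs (All.universal (λ _ → refl) xs)

All-pending : ∀ {P : Item → Set} c xs → All P xs → All P (pending c xs)
All-pending c []       []       = []
All-pending c (x ∷ xs) (p ∷ ps) with memb (proj₁ x) c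
... | true  = All-pending c xs ps
... | false = p ∷ All-pending c xs ps

removeId : ℕ → List Item → List Item
removeId i []       = []
removeId i (y ∷ ys) = if proj₁ y ≡ᵇ i then removeId i ys else y ∷ removeId i ys

pending-∷ : ∀ i c xs → pending (i ∷ c) xs ≡ removeId i (pending c xs)
pending-∷ i c []       = refl
pending-∷ i c (y ∷ ys) with memb (proj₁ y) c
... | true rewrite ∨-zeroʳ (proj₁ y ≡ᵇ i) = pending-∷ i c ys
... | false rewrite ∨-identityʳ (proj₁ y ≡ᵇ i) with proj₁ y ≡ᵇ i
...   | true  = pending-∷ i c ys
...   | false = cong (y ∷_) (pending-∷ i c ys)

removeId-++ : ∀ i xs ys → All (IdBelow i) xs → removeId i (xs ++ ys) ≡ xs ++ removeId i ys
removeId-++ i []       ys []           = refl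
removeId-++ i (x ∷ xs) ys (x<i ∷ x<is) rewrite ≢⇒≡ᵇ≡false (ℕ.<⇒≢ x<i) =
  cong (x ∷_) (removeId-++ i xs ys x<is)

weightℕ : Item → ℕ
weightℕ it = ℤ.∣ ↥ proj₂ it ∣

NaturalWeight : Item → Set
NaturalWeight it = proj₂ it ≡ fromℕ (weightℕ it)

weightSum : List Item → ℕ
weightSum = sum ∘ map weightℕ

weightSum-removeId : ∀ i xs → weightSum (removeId i xs) ℕ.≤ weightSum xs
weightSum-removeId i []       = ℕ.z≤n
weightSum-removeId i (y ∷ ys) with proj₁ y ≡ᵇ i
... | true  = ℕ.≤-trans (weightSum-removeId i ys) (ℕ.m≤n+m _ _)
... | false = ℕ.+-monoʳ-≤ (weightℕ y) (weightSum-removeId i ys)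

weightSum-lookup-removeId : ∀ xs (j : Fin (length xs)) → let z = lookup xs j in
  weightℕ z ℕ.+ weightSum (removeId (proj₁ z) xs) ℕ.≤ weightSum xs
weightSum-lookup-removeId (y ∷ ys) Fin.zero rewrite ≡ᵇ-refl (proj₁ y) =
  ℕ.+-monoʳ-≤ (weightℕ y) (weightSum-removeId (proj₁ y) ys)
weightSum-lookup-removeId (y ∷ ys) (Fin.suc j) with proj₁ y ≡ᵇ proj₁ (lookup ys j)
... | true  = ℕ.≤-trans (weightSum-lookup-removeId ys j) (ℕ.m≤n+m _ _)
... | false = ℕ.≤-trans (ℕ.≤-reflexive (x∙yz≈y∙xz (weightℕ z) (weightℕ y) (weightSum (removeId (proj₁ z) ys))))
                           (ℕ.+-monoʳ-≤ (weightℕ y) (weightSum-lookup-removeId ys j))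
  where
  z = lookup ys j

-- Ids count down along the list, since prependAll inserts its items back to front.
labelled : List ℕ → ℕ → List Item
labelled []       n = []
labelled (w ∷ ws) n = (length ws ℕ.+ n , fromℕ w) ∷ labelled ws n

prependAll : List ℕ → List Op
prependAll []       = []
prependAll (w ∷ ws) = prependAll ws ++ ins 0 (fromℕ w) ∷ []

applyOps-++ : ∀ s os os′ → applyOps s (os ++ os′) ≡ applyOps (applyOps s os) os′
applyOps-++ s []       os′ = refl
applyOps-++ s (o ∷ os) os′ = applyOps-++ (applyOp s o) os os′

applyOps-prependAll : ∀ ws q n c g →
  applyOps (st q n c g) (prependAll ws) ≡ st (labelled ws n ++ q) (length ws ℕ.+ n) c g
applyOps-prependAll []       q n c g = refl
applyOps-prependAll (w ∷ ws) q n c g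
  rewrite applyOps-++ (st q n c g) (prependAll ws) (ins 0 (fromℕ w) ∷ []) | applyOps-prependAll ws q n c g = refl

prependAll-nonNeg : ∀ ws → All OpNonNeg (prependAll ws)
prependAll-nonNeg []       = []
prependAll-nonNeg (w ∷ ws) = ++⁺ (prependAll-nonNeg ws) (fromℕ-nonNeg w ∷ [])

length-labelled : ∀ ws n → length (labelled ws n) ≡ length ws
length-labelled []       n = refl
length-labelled (w ∷ ws) n = cong suc (length-labelled ws n)

labelled-++ : ∀ xs ys n → labelled (xs ++ ys) n ≡ labelled xs (length ys ℕ.+ n) ++ labelled ys n
labelled-++ []       ys n = refl
labelled-++ (w ∷ xs) ys n = cong₂ _∷_ (cong (_, fromℕ w) id≡) (labelled-++ xs ys n)
  where
  id≡ : length (xs ++ ys) ℕ.+ n ≡ length xs ℕ.+ (length ys ℕ.+ n)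
  id≡ = trans (cong (ℕ._+ n) (List.length-++ xs)) (ℕ.+-assoc (length xs) (length ys) n)

map-proj₂-labelled : ∀ ws n → map proj₂ (labelled ws n) ≡ map fromℕ ws
map-proj₂-labelled []       n = refl
map-proj₂-labelled (w ∷ ws) n = cong (fromℕ w ∷_) (map-proj₂-labelled ws n)

labelled-idBelow : ∀ ws n → All (IdBelow (length ws ℕ.+ n)) (labelled ws n)
labelled-idBelow []       n = []
labelled-idBelow (w ∷ ws) n = ℕ.n<1+n _ ∷ All.map (λ p → ℕ.<-trans p (ℕ.n<1+n _)) (labelled-idBelow ws n)

labelled-uncollected : ∀ ws n c → All (ℕ._< n) c → All (Uncollected c) (labelled ws n)
labelled-uncollected []       n c c<n = []
labelled-uncollected (w ∷ ws) n c c<n =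
  all<⇒memb≡false c (All.map (λ i<n → ℕ.<-≤-trans i<n (ℕ.m≤n+m n (length ws))) c<n)
  ∷ labelled-uncollected ws n c c<n

labelled-naturalWeight : ∀ ws n → All NaturalWeight (labelled ws n)
labelled-naturalWeight []       n = []
labelled-naturalWeight (w ∷ ws) n = refl ∷ labelled-naturalWeight ws n

weightSum-labelled : ∀ ws n → weightSum (labelled ws n) ≡ sum ws
weightSum-labelled []       n = refl
weightSum-labelled (w ∷ ws) n = cong (w ℕ.+_) (weightSum-labelled ws n)

drop-labelled : ∀ ws m y ys → drop (suc (length ws)) (labelled ws m ++ y ∷ ys) ≡ ys
drop-labelled []       m y ys = refl
drop-labelled (v ∷ ws) m y ys = drop-labelled ws m y ys

pick : ℕ → (xs : List Item) → Maybe (Fin (length xs))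
pick k       []       = nothing
pick zero    (x ∷ xs) = just Fin.zero
pick (suc k) (x ∷ xs) = Maybe.map Fin.suc (pick k xs)

Picks : ∀ {n} → Maybe (Fin n) → ℕ → Set
Picks choice k = ∃[ j ] choice ≡ just j × toℕ j ≡ k

pick-length : ∀ {P : List Item} ys z zs → P ≡ ys ++ z ∷ zs → Picks (pick (length ys) P) (length ys)
pick-length []       z zs refl = Fin.zero , refl , refl
pick-length (y ∷ ys) z zs refl with pick-length ys z zs refl
... | j , e , tj rewrite e = Fin.suc j , refl , cong suc tj

lookup-at : ∀ {P : List Item} ys z zs → P ≡ ys ++ z ∷ zs → (i : Fin (length P)) → toℕ i ≡ length ys → lookup P i ≡ z
lookup-at []       z zs refl Fin.zero    _  = refl
lookup-at []       z zs refl (Fin.suc i) ()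
lookup-at (y ∷ ys) z zs refl Fin.zero    ()
lookup-at (y ∷ ys) z zs refl (Fin.suc i) e  = lookup-at ys z zs refl i (ℕ.suc-injective e)

collect-just : ∀ S t q n c g j → S t (pending c q) ≡ just j → let z = lookup (pending c q) j in
  collect S t (st q n c g) ≡ st q n (proj₁ z ∷ c) (g + proj₂ z)
collect-just S t q n c g j e rewrite e = refl

collect-nothing : ∀ S t q n c g → S t (pending c q) ≡ nothing → collect S t (st q n c g) ≡ st q n c g
collect-nothing S t q n c g e rewrite e = refl

collect-at : ∀ S t q n c g ys z zs → pending c q ≡ ys ++ z ∷ zs → Picks (S t (pending c q)) (length ys) →
  collect S t (st q n c g) ≡ st q n (proj₁ z ∷ c) (g + proj₂ z)
collect-at S t q n c g ys z zs eq (j , e , tj) =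
  trans (collect-just S t q n c g j e) (cong (λ y → st q n (proj₁ y ∷ c) (g + proj₂ y)) (lookup-at ys z zs eq j tj))

memoryless-picks : ∀ A t pend k → Picks (A (map proj₂ pend)) k → Picks (memorylessStrategy A t pend) k
memoryless-picks A t pend k (j , e , tj) rewrite e =
  cast (List.length-map proj₂ pend) j , refl , trans (Fin.toℕ-cast _ j) tj

memoryless-nothing : ∀ A t pend → A (map proj₂ pend) ≡ nothing → memorylessStrategy A t pend ≡ nothing
memoryless-nothing A t pend e rewrite e = refl

runFrom-++ : ∀ S t s I J → runFrom S t s (I ++ J) ≡ runFrom S (length I ℕ.+ t) (runFrom S t s I) J
runFrom-++ S t s []       J = refl
runFrom-++ S t s (os ∷ I) J =
  trans (runFrom-++ S (suc t) s′ I J) (cong (λ u → runFrom S u (runFrom S (suc t) s′ I) J) (ℕ.+-suc (length I) t))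
  where s′ = collect S t (applyOps s os)

gain-idle-≤ : ∀ S k t q n c g → All NaturalWeight q →
  ∃[ g′ ] State.gain (runFrom S t (st q n c (fromℕ g)) (replicate k [])) ≡ fromℕ g′ × g′ ℕ.≤ g ℕ.+ weightSum (pending c q)
gain-idle-≤ S zero    t q n c g nat = g , refl , ℕ.m≤m+n g _
gain-idle-≤ S (suc k) t q n c g nat with S t (pending c q)
... | nothing = gain-idle-≤ S k (suc t) q n c g nat
... | just j =
  let g′ , e′ , g′≤ = gain-idle-≤ S k (suc t) q n (proj₁ z ∷ c) (g ℕ.+ weightℕ z) nat
  in g′ , trans (cong (λ s → State.gain (runFrom S (suc t) s (replicate k []))) collected) e′ , ℕ.≤-trans g′≤ bound
  where
  open ℕ.≤-Reasoning
  z = lookup (pending c q) j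
  collected : st q n (proj₁ z ∷ c) (fromℕ g + proj₂ z) ≡ st q n (proj₁ z ∷ c) (fromℕ (g ℕ.+ weightℕ z))
  collected = cong (st q n (proj₁ z ∷ c))
    (trans (cong (λ w → fromℕ g + w) (All.lookup (All-pending c q nat) (∈-lookup j))) (fromℕ-+ g (weightℕ z)))
  bound : g ℕ.+ weightℕ z ℕ.+ weightSum (pending (proj₁ z ∷ c) q) ℕ.≤ g ℕ.+ weightSum (pending c q)
  bound = begin
    g ℕ.+ weightℕ z ℕ.+ weightSum (pending (proj₁ z ∷ c) q)
      ≡⟨ ℕ.+-assoc g (weightℕ z) _ ⟩
    g ℕ.+ (weightℕ z ℕ.+ weightSum (pending (proj₁ z ∷ c) q))
      ≡⟨ cong (λ p → g ℕ.+ (weightℕ z ℕ.+ weightSum p)) (pending-∷ (proj₁ z) c q) ⟩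
    g ℕ.+ (weightℕ z ℕ.+ weightSum (removeId (proj₁ z) (pending c q)))
      ≤⟨ ℕ.+-monoʳ-≤ g (weightSum-lookup-removeId (pending c q) j) ⟩
    g ℕ.+ weightSum (pending c q) ∎

-- The repeated-pick adversary

module RepeatedPick (pre : List ℕ) (q x : ℕ) (post : List ℕ) (r : ℕ) where

  W : List ℕ
  W = pre ++ q ∷ x ∷ []

  w : ℕ
  w = length W

  cut : ℕ
  cut = suc (length pre)

  P₀ : ℕ
  P₀ = length post ℕ.+ 0

  postItems : List Item
  postItems = labelled post 0

  xItems : List ℕ → List Item
  xItems = map (_, fromℕ x)

  queue : ℕ → List ℕ → List Item
  queue n bs = labelled W n ++ xItems bs ++ postItems

  stateAt : ℕ → List ℕ → List ℕ → ℚ → State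
  stateAt n bs c g = st (queue n bs) (w ℕ.+ n) c g

  roundOps : List Op
  roundOps = del cut ∷ prependAll W

  finalOps : Instance
  finalOps = (del cut ∷ []) ∷ replicate r []

  adversary : Instance
  adversary = prependAll (W ++ post) ∷ replicate r roundOps ++ finalOps

  adversary-nonNeg : NonNeg adversary
  adversary-nonNeg = prependAll-nonNeg (W ++ post)
    ∷ ++⁺ (replicate⁺ r (ℚ.≤-refl ∷ prependAll-nonNeg W)) ((ℚ.≤-refl ∷ []) ∷ replicate⁺ r [])

  w≡ : w ≡ suc (suc (length pre))
  w≡ = trans (List.length-++ pre) (ℕ.+-comm (length pre) 2)

  n<w+n : ∀ n → n ℕ.< w ℕ.+ n
  n<w+n n = subst (λ k → n ℕ.< k ℕ.+ n) (sym w≡) (ℕ.s≤s (ℕ.m≤n+m n _))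

  1+n<w+n : ∀ n → suc n ℕ.< w ℕ.+ n
  1+n<w+n n = subst (λ k → suc n ℕ.< k ℕ.+ n) (sym w≡) (ℕ.s≤s (ℕ.s≤s (ℕ.m≤n+m n _)))

  queue-≡ : ∀ n bs → queue n bs ≡ labelled pre (2 ℕ.+ n) ++ (suc n , fromℕ q) ∷ (n , fromℕ x) ∷ xItems bs ++ postItems
  queue-≡ n bs = trans (cong (_++ _) (labelled-++ pre (q ∷ x ∷ []) n)) (List.++-assoc (labelled pre (2 ℕ.+ n)) _ _)

  drop-cut : ∀ n bs → drop cut (queue n bs) ≡ xItems (n ∷ bs) ++ postItems
  drop-cut n bs = trans (cong (drop cut) (queue-≡ n bs)) (drop-labelled pre (2 ℕ.+ n) _ _)

  roundOps-stateAt : ∀ n bs c g → applyOps (stateAt n bs c g) roundOps ≡ stateAt (w ℕ.+ n) (n ∷ bs) c g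
  roundOps-stateAt n bs c g rewrite drop-cut n bs = applyOps-prependAll W _ (w ℕ.+ n) c g

  initial-stateAt : applyOps (st [] 0 [] 0ℚ) (prependAll (W ++ post)) ≡ stateAt P₀ [] [] 0ℚ
  initial-stateAt = trans (applyOps-prependAll (W ++ post) [] 0 [] 0ℚ) (cong₂ (λ Q n → st Q n [] 0ℚ) queue≡ nextId≡)
    where
    queue≡ : labelled (W ++ post) 0 ++ [] ≡ queue P₀ []
    queue≡ = trans (List.++-identityʳ _) (labelled-++ W post 0)
    nextId≡ : length (W ++ post) ℕ.+ 0 ≡ w ℕ.+ P₀
    nextId≡ = trans (cong (ℕ._+ 0) (List.length-++ W)) (ℕ.+-assoc w (length post) 0)

  gainOf-adversary : ∀ S → gainOf S adversary ≡
    State.gain (runFrom S (suc r) (runFrom S 1 (collect S 0 (stateAt P₀ [] [] 0ℚ)) (replicate r roundOps)) finalOps)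
  gainOf-adversary S = cong State.gain (trans
    (cong (λ s → runFrom S 1 (collect S 0 s) (replicate r roundOps ++ finalOps)) initial-stateAt)
    (trans (runFrom-++ S 1 s₀ (replicate r roundOps) finalOps)
           (cong (λ t → runFrom S t (runFrom S 1 s₀ (replicate r roundOps)) finalOps) r+1≡)))
    where
    s₀ = collect S 0 (stateAt P₀ [] [] 0ℚ)
    r+1≡ : length (replicate r roundOps) ℕ.+ 1 ≡ suc r
    r+1≡ = trans (cong (ℕ._+ 1) (List.length-replicate r)) (ℕ.+-comm r 1)

  post<P₀ : All (IdBelow P₀) postItems
  post<P₀ = labelled-idBelow post 0

  post-uncollected : ∀ c → All (P₀ ℕ.≤_) c → All (Uncollected c) postItems
  post-uncollected c P₀≤c = uncollected-below c P₀≤c post<P₀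

  module Online (A : Memoryless) (picks-x : Picks (A (map fromℕ (pre ++ q ∷ x ∷ post))) cut) where

    SA : Strategy
    SA = memorylessStrategy A

    pending-online : ∀ m bs c → All (ℕ._< m) c → All (λ i → memb i c ≡ true) bs → All (P₀ ℕ.≤_) c →
      pending c (queue m bs) ≡ labelled W m ++ postItems
    pending-online m bs c c<m bs∈c P₀≤c = begin
      pending c (labelled W m ++ xItems bs ++ postItems)
        ≡⟨ pending-++ c (labelled W m) _ ⟩
      pending c (labelled W m) ++ pending c (xItems bs ++ postItems)
        ≡⟨ cong (pending c (labelled W m) ++_) (pending-++ c (xItems bs) postItems) ⟩
      pending c (labelled W m) ++ pending c (xItems bs) ++ pending c postItems
        ≡⟨ cong₂ (λ u v → u ++ v ++ pending c postItems)
                 (pending-uncollected c _ (labelled-uncollected W m c c<m))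
                 (pending-collected c (xItems bs) (map⁺ bs∈c)) ⟩
      labelled W m ++ pending c postItems
        ≡⟨ cong (labelled W m ++_) (pending-uncollected c postItems (post-uncollected c P₀≤c)) ⟩
      labelled W m ++ postItems ∎
      where open ≡-Reasoning

    -- Having collected every earlier x, A sees exactly the weights of pre ++ q ∷ x ∷ post again.
    collect-online : ∀ t m bs c g → All (ℕ._< m) c → All (λ i → memb i c ≡ true) bs → All (P₀ ℕ.≤_) c →
      collect SA t (stateAt m bs c g) ≡ stateAt m bs (m ∷ c) (g + fromℕ x)
    collect-online t m bs c g c<m bs∈c P₀≤c =
      collect-at SA t (queue m bs) (w ℕ.+ m) c g before (m , fromℕ x) postItems split
        (memoryless-picks A t _ (length before) (subst₂ (λ ws k → Picks (A ws) k) (sym weights) cut≡ picks-x))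
      where
      before = labelled pre (2 ℕ.+ m) ++ (suc m , fromℕ q) ∷ []
      pending≡ = pending-online m bs c c<m bs∈c P₀≤c
      split : pending c (queue m bs) ≡ before ++ (m , fromℕ x) ∷ postItems
      split = trans pending≡ (trans (cong (_++ postItems) (labelled-++ pre (q ∷ x ∷ []) m))
        (trans (List.++-assoc (labelled pre (2 ℕ.+ m)) _ postItems) (sym (List.++-assoc (labelled pre (2 ℕ.+ m)) _ _))))
      weights : map proj₂ (pending c (queue m bs)) ≡ map fromℕ (pre ++ q ∷ x ∷ post)
      weights = begin
        map proj₂ (pending c (queue m bs))         ≡⟨ cong (map proj₂) pending≡ ⟩
        map proj₂ (labelled W m ++ postItems)      ≡⟨ List.map-++ proj₂ (labelled W m) postItems ⟩
        map proj₂ (labelled W m) ++ map proj₂ postItems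
          ≡⟨ cong₂ _++_ (map-proj₂-labelled W m) (map-proj₂-labelled post 0) ⟩
        map fromℕ W ++ map fromℕ post             ≡⟨ List.map-++ fromℕ W post ⟨
        map fromℕ (W ++ post)                      ≡⟨ cong (map fromℕ) (List.++-assoc pre (q ∷ x ∷ []) post) ⟩
        map fromℕ (pre ++ q ∷ x ∷ post)            ∎
        where open ≡-Reasoning
      cut≡ : cut ≡ length before
      cut≡ = sym (trans (List.length-++ (labelled pre (2 ℕ.+ m)))
                        (trans (cong (ℕ._+ 1) (length-labelled pre _)) (ℕ.+-comm (length pre) 1)))

    InRange : ℕ → List ℕ → Set
    InRange n bs = All (λ i → P₀ ℕ.≤ i × i ℕ.≤ n) (n ∷ bs)

    inRange-step : ∀ {n bs} → InRange n bs → InRange (w ℕ.+ n) (n ∷ bs)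
    inRange-step {n} inRange@((P₀≤n , _) ∷ _) =
      (ℕ.≤-trans P₀≤n (ℕ.m≤n+m n w) , ℕ.≤-refl)
      ∷ All.map (λ (P₀≤i , i≤n) → P₀≤i , ℕ.≤-trans i≤n (ℕ.m≤n+m n w)) inRange

    online-round : ∀ t n bs G → InRange n bs →
      collect SA t (applyOps (stateAt n bs (n ∷ bs) (fromℕ G)) roundOps)
        ≡ stateAt (w ℕ.+ n) (n ∷ bs) (w ℕ.+ n ∷ n ∷ bs) (fromℕ (G ℕ.+ x))
    online-round t n bs G inRange rewrite roundOps-stateAt n bs (n ∷ bs) (fromℕ G) =
      trans (collect-online t (w ℕ.+ n) (n ∷ bs) (n ∷ bs) (fromℕ G) c<m (memb-self (n ∷ bs)) (All.map proj₁ inRange))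
            (cong (stateAt (w ℕ.+ n) (n ∷ bs) _) (fromℕ-+ G x))
      where
      c<m : All (ℕ._< w ℕ.+ n) (n ∷ bs)
      c<m = All.map (λ (_ , i≤n) → ℕ.≤-<-trans i≤n (n<w+n n)) inRange

    online-rounds : ∀ k t n bs G → InRange n bs → ∃[ n′ ] ∃[ bs′ ] InRange n′ bs′ ×
      runFrom SA t (stateAt n bs (n ∷ bs) (fromℕ G)) (replicate k roundOps)
        ≡ stateAt n′ bs′ (n′ ∷ bs′) (fromℕ (k ℕ.* x ℕ.+ G))
    online-rounds zero    t n bs G inRange = n , bs , inRange , refl
    online-rounds (suc k) t n bs G inRange =
      let n′ , bs′ , inRange′ , e = online-rounds k (suc t) (w ℕ.+ n) (n ∷ bs) (G ℕ.+ x) (inRange-step inRange)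
      in n′ , bs′ , inRange′ ,
         trans (cong (λ s → runFrom SA (suc t) s (replicate k roundOps)) (online-round t n bs G inRange))
               (trans e (cong (λ v → stateAt n′ bs′ (n′ ∷ bs′) (fromℕ v)) (accumulate k x G)))

    online-final : ∀ n bs G → InRange n bs → ∃[ G′ ]
      State.gain (runFrom SA (suc r) (stateAt n bs (n ∷ bs) (fromℕ G)) finalOps) ≡ fromℕ G′ × G′ ℕ.≤ G ℕ.+ sum post
    online-final n bs G inRange =
      let G′ , e , G′≤ = gain-idle-≤ SA (suc r) (suc r) (drop cut (queue n bs)) (w ℕ.+ n) (n ∷ bs) G naturals
      in G′ , e , ℕ.≤-trans G′≤ (ℕ.≤-reflexive (cong (G ℕ.+_) remaining))
      where
      naturals : All NaturalWeight (drop cut (queue n bs))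
      naturals = subst (All NaturalWeight) (sym (drop-cut n bs))
                       (++⁺ (map⁺ (All.universal (λ _ → refl) (n ∷ bs))) (labelled-naturalWeight post 0))
      remaining : weightSum (pending (n ∷ bs) (drop cut (queue n bs))) ≡ sum post
      remaining = begin
        weightSum (pending (n ∷ bs) (drop cut (queue n bs)))
          ≡⟨ cong (weightSum ∘ pending (n ∷ bs)) (drop-cut n bs) ⟩
        weightSum (pending (n ∷ bs) (xItems (n ∷ bs) ++ postItems))
          ≡⟨ cong weightSum (pending-++ (n ∷ bs) (xItems (n ∷ bs)) postItems) ⟩
        weightSum (pending (n ∷ bs) (xItems (n ∷ bs)) ++ pending (n ∷ bs) postItems)
          ≡⟨ cong₂ (λ u v → weightSum (u ++ v)) (pending-collected (n ∷ bs) _ (map⁺ (memb-self (n ∷ bs))))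
                   (pending-uncollected (n ∷ bs) postItems (post-uncollected (n ∷ bs) (All.map proj₁ inRange))) ⟩
        weightSum postItems
          ≡⟨ weightSum-labelled post 0 ⟩
        sum post ∎
        where open ≡-Reasoning

    online-first : collect SA 0 (stateAt P₀ [] [] 0ℚ) ≡ stateAt P₀ [] (P₀ ∷ []) (fromℕ x)
    online-first = trans (collect-online 0 P₀ [] [] 0ℚ [] [] []) (cong (stateAt P₀ [] (P₀ ∷ [])) (fromℕ-+ 0 x))

    online-gain : ∃[ G ] gainOf SA adversary ≡ fromℕ G × G ℕ.≤ suc r ℕ.* x ℕ.+ sum post
    online-gain with online-rounds r 1 P₀ [] x ((ℕ.≤-refl , ℕ.≤-refl) ∷ [])
    ... | n , bs , inRange , rounds with online-final n bs (r ℕ.* x ℕ.+ x) inRange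
    ...   | G , final , G≤ =
      G , trans (gainOf-adversary SA) (trans (cong (λ s → State.gain (runFrom SA (suc r) s finalOps)) start) final) ,
      ℕ.≤-trans G≤ (ℕ.≤-reflexive (cong (ℕ._+ sum post) (ℕ.+-comm (r ℕ.* x) x)))
      where
      start : runFrom SA 1 (collect SA 0 (stateAt P₀ [] [] 0ℚ)) (replicate r roundOps)
            ≡ stateAt n bs (n ∷ bs) (fromℕ (r ℕ.* x ℕ.+ x))
      start = trans (cong (λ s → runFrom SA 1 s (replicate r roundOps)) online-first) rounds

  offline : Strategy
  offline t pend = if t <ᵇ suc r then pick (length pre) pend else pick 0 pend

  offline-picks-q : ∀ {t} {P : List Item} ys z zs → t ℕ.< suc r → length ys ≡ length pre →
    P ≡ ys ++ z ∷ zs → Picks (offline t P) (length ys)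
  offline-picks-q ys z zs t<r ys≡pre eq rewrite <⇒<ᵇ≡true t<r | sym ys≡pre = pick-length ys z zs eq

  offline-picks-head : ∀ {t} {P : List Item} z zs → suc r ℕ.≤ t → P ≡ z ∷ zs → Picks (offline t P) 0
  offline-picks-head z zs r<t eq rewrite ≥⇒<ᵇ≡false r<t = pick-length [] z zs eq

  collect-offline : ∀ t m bs c g → t ℕ.< suc r → All (ℕ._< m) c → All (Uncollected c) (xItems bs) → All (P₀ ℕ.≤_) c →
    collect offline t (stateAt m bs c g) ≡ stateAt m bs (suc m ∷ c) (g + fromℕ q)
  collect-offline t m bs c g t<r c<m xs-pending P₀≤c =
    collect-at offline t (queue m bs) (w ℕ.+ m) c g (labelled pre (2 ℕ.+ m)) (suc m , fromℕ q) _ split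
      (offline-picks-q (labelled pre (2 ℕ.+ m)) _ _ t<r (length-labelled pre _) split)
    where
    split : pending c (queue m bs) ≡ labelled pre (2 ℕ.+ m) ++ (suc m , fromℕ q) ∷ (m , fromℕ x) ∷ xItems bs ++ postItems
    split = trans (pending-uncollected c (queue m bs)
                    (++⁺ (labelled-uncollected W m c c<m) (++⁺ xs-pending (post-uncollected c P₀≤c))))
                  (queue-≡ m bs)

  record Unpicked (n : ℕ) (bs c : List ℕ) : Set where
    field
      c<next     : All (ℕ._< w ℕ.+ n) c
      xs-pending : All (Uncollected c) (xItems (n ∷ bs))
      descending : AllPairs ℕ._>_ (n ∷ bs)
      P₀≤c       : All (P₀ ℕ.≤_) c
      P₀≤n       : P₀ ℕ.≤ n

  unpicked-step : ∀ {n bs c} → Unpicked n bs c → Unpicked (w ℕ.+ n) (n ∷ bs) (suc (w ℕ.+ n) ∷ c)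
  unpicked-step {n} {bs} {c} u = record
    { c<next     = 1+n<w+n n′ ∷ All.map (λ i<n′ → ℕ.<-trans i<n′ (n<w+n n′)) c<next
    ; xs-pending = memb-∷-false c (ℕ.<⇒≢ (ℕ.n<1+n n′)) (all<⇒memb≡false c c<next)
                 ∷ uncollected-∷ c (map⁺ (All.map (λ i<n′ → ℕ.<-trans i<n′ (ℕ.n<1+n n′)) below)) xs-pending
    ; descending = below ∷ descending
    ; P₀≤c       = ℕ.m≤n⇒m≤1+n P₀≤n′ ∷ P₀≤c
    ; P₀≤n       = P₀≤n′
    }
    where
    open Unpicked u
    n′ = w ℕ.+ n
    P₀≤n′ = ℕ.≤-trans P₀≤n (ℕ.m≤n+m n w)
    below : All (ℕ._< n′) (n ∷ bs)
    below with descending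
    ... | bs<n ∷ _ = n<w+n n ∷ All.map (λ b<n → ℕ.<-trans b<n (n<w+n n)) bs<n

  offline-round : ∀ t n bs c G → t ℕ.< suc r → Unpicked n bs c →
    collect offline t (applyOps (stateAt n bs c (fromℕ G)) roundOps)
      ≡ stateAt (w ℕ.+ n) (n ∷ bs) (suc (w ℕ.+ n) ∷ c) (fromℕ (G ℕ.+ q))
  offline-round t n bs c G t<r u rewrite roundOps-stateAt n bs c (fromℕ G) =
    trans (collect-offline t (w ℕ.+ n) (n ∷ bs) c (fromℕ G) t<r c<next xs-pending P₀≤c)
          (cong (stateAt (w ℕ.+ n) (n ∷ bs) _) (fromℕ-+ G q))
    where open Unpicked u

  offline-rounds : ∀ k t n bs c G → k ℕ.+ t ℕ.≤ suc r → Unpicked n bs c →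
    ∃[ n′ ] ∃[ bs′ ] ∃[ c′ ] Unpicked n′ bs′ c′ × length bs′ ≡ k ℕ.+ length bs ×
      runFrom offline t (stateAt n bs c (fromℕ G)) (replicate k roundOps) ≡ stateAt n′ bs′ c′ (fromℕ (k ℕ.* q ℕ.+ G))
  offline-rounds zero    t n bs c G _     u = n , bs , c , u , refl , refl
  offline-rounds (suc k) t n bs c G k+t≤r u =
    let n′ , bs′ , c′ , u′ , len , e = offline-rounds k (suc t) (w ℕ.+ n) (n ∷ bs) (suc (w ℕ.+ n) ∷ c) (G ℕ.+ q)
                                         (subst (ℕ._≤ suc r) (sym (ℕ.+-suc k t)) k+t≤r) (unpicked-step u)
    in n′ , bs′ , c′ , u′ , trans len (ℕ.+-suc k (length bs)) ,
       trans (cong (λ s → runFrom offline (suc t) s (replicate k roundOps)) (offline-round t n bs c G t<r u))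
             (trans e (cong (λ v → stateAt n′ bs′ c′ (fromℕ v)) (accumulate k q G)))
    where
    t<r : t ℕ.< suc r
    t<r = ℕ.<-≤-trans (ℕ.m<n+m t (ℕ.s≤s ℕ.z≤n)) k+t≤r

  offline-collects-xs : ∀ bs t Q m c G Y → suc r ℕ.≤ t → All (Uncollected c) (xItems bs) → AllPairs ℕ._>_ bs →
    pending c Q ≡ xItems bs ++ Y →
    State.gain (runFrom offline t (st Q m c (fromℕ G)) (replicate (length bs) [])) ≡ fromℕ (length bs ℕ.* x ℕ.+ G)
  offline-collects-xs []       t Q m c G Y _   _        _                   _  = refl
  offline-collects-xs (b ∷ bs) t Q m c G Y r<t (u ∷ us) (bs<b ∷ descending) eq =
    trans (cong (λ s → State.gain (runFrom offline (suc t) s (replicate (length bs) []))) collected)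
          (trans (offline-collects-xs bs (suc t) Q m (b ∷ c) (G ℕ.+ x) (removeId b Y) (ℕ.m≤n⇒m≤1+n r<t)
                   (uncollected-∷ c (map⁺ bs<b) us) descending eq′)
                 (cong fromℕ (accumulate (length bs) x G)))
    where
    collected : collect offline t (st Q m c (fromℕ G)) ≡ st Q m (b ∷ c) (fromℕ (G ℕ.+ x))
    collected = trans (collect-at offline t Q m c (fromℕ G) [] (b , fromℕ x) _ eq (offline-picks-head _ _ r<t eq))
                      (cong (st Q m (b ∷ c)) (fromℕ-+ G x))
    eq′ : pending (b ∷ c) Q ≡ xItems bs ++ removeId b Y
    eq′ rewrite pending-∷ b c Q | eq | ≡ᵇ-refl b = removeId-++ b (xItems bs) Y (map⁺ bs<b)

  unpicked-start : Unpicked P₀ [] (suc P₀ ∷ [])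
  unpicked-start = record
    { c<next     = 1+n<w+n P₀ ∷ []
    ; xs-pending = memb-∷-false [] (ℕ.<⇒≢ (ℕ.n<1+n P₀)) refl ∷ []
    ; descending = [] ∷ []
    ; P₀≤c       = ℕ.n≤1+n P₀ ∷ []
    ; P₀≤n       = ℕ.≤-refl
    }

  offline-first : collect offline 0 (stateAt P₀ [] [] 0ℚ) ≡ stateAt P₀ [] (suc P₀ ∷ []) (fromℕ q)
  offline-first = trans (collect-offline 0 P₀ [] [] 0ℚ (ℕ.s≤s ℕ.z≤n) [] [] [])
                        (cong (stateAt P₀ [] (suc P₀ ∷ [])) (fromℕ-+ 0 q))

  offline-gain : gainOf offline adversary ≡ fromℕ (suc r ℕ.* (q ℕ.+ x))
  offline-gain with offline-rounds r 1 P₀ [] (suc P₀ ∷ []) q (ℕ.≤-reflexive (ℕ.+-comm r 1)) unpicked-start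
  ... | n , bs , c , u , len , rounds = begin
    gainOf offline adversary
      ≡⟨ gainOf-adversary offline ⟩
    State.gain (runFrom offline (suc r) (runFrom offline 1 s₀ (replicate r roundOps)) finalOps)
      ≡⟨ cong (λ s → State.gain (runFrom offline (suc r) s finalOps)) start ⟩
    sweep (suc r)
      ≡⟨ cong (sweep ∘ suc) (sym len′) ⟩
    sweep (length (n ∷ bs))
      ≡⟨ offline-collects-xs (n ∷ bs) (suc r) _ _ c _ postItems ℕ.≤-refl xs-pending descending pending≡ ⟩
    fromℕ (suc (length bs) ℕ.* x ℕ.+ (r ℕ.* q ℕ.+ q))
      ≡⟨ cong fromℕ (trans (cong (λ k → suc k ℕ.* x ℕ.+ (r ℕ.* q ℕ.+ q)) len′) (rounds-total r q x)) ⟩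
    fromℕ (suc r ℕ.* (q ℕ.+ x)) ∎
    where
    open ≡-Reasoning
    open Unpicked u
    s₀ = collect offline 0 (stateAt P₀ [] [] 0ℚ)
    start : runFrom offline 1 s₀ (replicate r roundOps) ≡ stateAt n bs c (fromℕ (r ℕ.* q ℕ.+ q))
    start = trans (cong (λ s → runFrom offline 1 s (replicate r roundOps)) offline-first) rounds
    sweep : ℕ → ℚ
    sweep k = State.gain (runFrom offline (suc r) (st (drop cut (queue n bs)) (w ℕ.+ n) c (fromℕ (r ℕ.* q ℕ.+ q)))
                                  (replicate k []))
    len′ : length bs ≡ r
    len′ = trans len (ℕ.+-identityʳ r)
    pending≡ : pending c (drop cut (queue n bs)) ≡ xItems (n ∷ bs) ++ postItems
    pending≡ = trans (cong (pending c) (drop-cut n bs))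
                     (pending-uncollected c _ (++⁺ xs-pending (post-uncollected c P₀≤c)))

-- Single-step instances

oneShot : List ℕ → Instance
oneShot ws = prependAll ws ∷ []

atPosition : ℕ → Strategy
atPosition k _ = pick k

applyOps-oneShot : ∀ ws → applyOps (st [] 0 [] 0ℚ) (prependAll ws) ≡ st (labelled ws 0) (length ws ℕ.+ 0) [] 0ℚ
applyOps-oneShot ws =
  trans (applyOps-prependAll ws [] 0 [] 0ℚ) (cong (λ Q → st Q (length ws ℕ.+ 0) [] 0ℚ) (List.++-identityʳ (labelled ws 0)))

atPosition-picks : ∀ t ys z zs n → Picks (atPosition (length ys) t (labelled (ys ++ z ∷ zs) n)) (length ys)
atPosition-picks t ys z zs n =
  subst₂ (λ k k′ → Picks (pick k (labelled (ys ++ z ∷ zs) n)) k′) len len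
    (pick-length (labelled ys (length (z ∷ zs) ℕ.+ n)) _ (labelled zs n) (labelled-++ ys (z ∷ zs) n))
  where len = length-labelled ys _

gainOf-oneShot : ∀ S ys z zs → Picks (S 0 (labelled (ys ++ z ∷ zs) 0)) (length ys) →
  gainOf S (oneShot (ys ++ z ∷ zs)) ≡ fromℕ z
gainOf-oneShot S ys z zs picks = begin
  gainOf S (oneShot ws)
    ≡⟨ cong (State.gain ∘ collect S 0) (applyOps-oneShot ws) ⟩
  State.gain (collect S 0 (st Q (length ws ℕ.+ 0) [] 0ℚ))
    ≡⟨ cong State.gain (collect-at S 0 Q _ [] 0ℚ (labelled ys _) _ (labelled zs 0) split picks′) ⟩
  0ℚ + fromℕ z
    ≡⟨ fromℕ-+ 0 z ⟩
  fromℕ z ∎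
  where
  open ≡-Reasoning
  ws = ys ++ z ∷ zs
  Q = labelled ws 0
  split : pending [] Q ≡ labelled ys (length (z ∷ zs) ℕ.+ 0) ++ (length zs ℕ.+ 0 , fromℕ z) ∷ labelled zs 0
  split = trans (pending-[] Q) (labelled-++ ys (z ∷ zs) 0)
  picks′ : Picks (S 0 (pending [] Q)) (length (labelled ys (length (z ∷ zs) ℕ.+ 0)))
  picks′ = subst₂ (λ P k → Picks (S 0 P) k) (sym (pending-[] Q)) (sym (length-labelled ys _)) picks

gainOf-oneShot-idle : ∀ S ws → S 0 (labelled ws 0) ≡ nothing → gainOf S (oneShot ws) ≡ 0ℚ
gainOf-oneShot-idle S ws idle = cong State.gain (trans (cong (collect S 0) (applyOps-oneShot ws))
  (collect-nothing S 0 (labelled ws 0) _ [] 0ℚ (subst (λ P → S 0 P ≡ nothing) (sym (pending-[] (labelled ws 0))) idle)))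

memoryless-picks-labelled : ∀ A t ws n k → Picks (A (map fromℕ ws)) k → Picks (memorylessStrategy A t (labelled ws n)) k
memoryless-picks-labelled A t ws n k picks =
  memoryless-picks A t (labelled ws n) k (subst (λ v → Picks (A v) k) (sym (map-proj₂-labelled ws n)) picks)

memoryless-idle-labelled : ∀ A t ws n → A (map fromℕ ws) ≡ nothing → memorylessStrategy A t (labelled ws n) ≡ nothing
memoryless-idle-labelled A t ws n idle =
  memoryless-nothing A t (labelled ws n) (subst (λ v → A v ≡ nothing) (sym (map-proj₂-labelled ws n)) idle)

¬Competitive-idle : ∀ A R w ws → A (map fromℕ (suc w ∷ ws)) ≡ nothing → ¬ Competitive R A
¬Competitive-idle A R w ws idle competitive =
  fromℕ-suc≰0 w (subst₂ _≤_ opt online (competitive (oneShot ws′) nonNeg (atPosition 0)))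
  where
  ws′ = suc w ∷ ws
  nonNeg = prependAll-nonNeg ws′ ∷ []
  opt : gainOf (atPosition 0) (oneShot ws′) ≡ fromℕ (suc w)
  opt = gainOf-oneShot (atPosition 0) [] (suc w) ws (atPosition-picks 0 [] (suc w) ws 0)
  online : R * gainOf (memorylessStrategy A) (oneShot ws′) ≡ 0ℚ
  online = trans (cong (R *_) (gainOf-oneShot-idle (memorylessStrategy A) ws′ (memoryless-idle-labelled A 0 ws′ 0 idle)))
                 (ℚ.*-zeroʳ R)

¬Competitive-oneShot : ∀ A R → R < 1ℚ + 1ℚ → ∀ ys z zs ys′ z′ zs′ → ys ++ z ∷ zs ≡ ys′ ++ z′ ∷ zs′ →
  Picks (A (map fromℕ (ys ++ z ∷ zs))) (length ys) → (2 ℕ.* ↧ₙ R ∸ 1) ℕ.* z ℕ.< ↧ₙ R ℕ.* z′ → ¬ Competitive R A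
¬Competitive-oneShot A R R<2 ys z zs ys′ z′ zs′ same picks ratio competitive =
  fromℕ≰*fromℕ R R<2 z′ z ratio
    (subst₂ (λ u v → u ≤ R * v) opt online (competitive (oneShot ws) nonNeg (atPosition (length ys′))))
  where
  ws = ys ++ z ∷ zs
  nonNeg = prependAll-nonNeg ws ∷ []
  opt : gainOf (atPosition (length ys′)) (oneShot ws) ≡ fromℕ z′
  opt rewrite same = gainOf-oneShot (atPosition (length ys′)) ys′ z′ zs′ (atPosition-picks 0 ys′ z′ zs′ 0)
  online : gainOf (memorylessStrategy A) (oneShot ws) ≡ fromℕ z
  online = gainOf-oneShot (memorylessStrategy A) ys z zs (memoryless-picks-labelled A 0 ws 0 (length ys) picks)

¬Competitive-repeated : ∀ A R → R < 1ℚ + 1ℚ → ∀ pre q x post →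
  Picks (A (map fromℕ (pre ++ q ∷ x ∷ post))) (suc (length pre)) →
  (2 ℕ.* ↧ₙ R ∸ 1) ℕ.* x ℕ.< ↧ₙ R ℕ.* (q ℕ.+ x) → ¬ Competitive R A
¬Competitive-repeated A R R<2 pre q x post picks ratio competitive =
  fromℕ≰*fromℕ R R<2 _ G (amplify D (↧ₙ R) x (q ℕ.+ x) (sum post) G ratio G≤)
    (subst₂ (λ u v → u ≤ R * v) offline-gain online (competitive adversary adversary-nonNeg offline))
  where
  D = 2 ℕ.* ↧ₙ R ∸ 1
  open RepeatedPick pre q x post (D ℕ.* sum post)
  open Online A picks
  G = proj₁ online-gain
  online = proj₁ (proj₂ online-gain)
  G≤ = proj₂ (proj₂ online-gain)

-- The ladder k, k+1, …, 2k

ladder : ℕ → ℕ → List ℕ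
ladder s zero    = []
ladder s (suc l) = s ∷ ladder (suc s) l

length-ladder : ∀ s l → length (ladder s l) ≡ l
length-ladder s zero    = refl
length-ladder s (suc l) = cong suc (length-ladder (suc s) l)

ladder-+ : ∀ s i l → ladder s (i ℕ.+ l) ≡ ladder s i ++ ladder (i ℕ.+ s) l
ladder-+ s zero    l = refl
ladder-+ s (suc i) l =
  cong (s ∷_) (trans (ladder-+ (suc s) i l) (cong (λ v → ladder (suc s) i ++ ladder v l) (ℕ.+-suc i s)))

ladder-split : ∀ s l i → suc i ℕ.< l →
  ∃[ l′ ] ladder s l ≡ ladder s i ++ (i ℕ.+ s) ∷ suc (i ℕ.+ s) ∷ ladder (suc (suc (i ℕ.+ s))) l′
ladder-split s l i 1+i<l =
  let l′ , 2+i+l′≡l = ℕ.m≤n⇒∃[o]m+o≡n 1+i<l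
  in l′ , trans (cong (ladder s) (trans (sym 2+i+l′≡l) (shift i l′))) (ladder-+ s i (suc (suc l′)))
  where
  shift : ∀ a b → suc (suc a) ℕ.+ b ≡ a ℕ.+ suc (suc b)
  shift = solve-∀

toℕ<length-ladder : ∀ s l (j : Fin (length (map fromℕ (ladder s l)))) → toℕ j ℕ.< l
toℕ<length-ladder s l j =
  subst (toℕ j ℕ.<_) (trans (List.length-map fromℕ (ladder s l)) (length-ladder s l)) (Fin.toℕ<n j)

2[1+d]∸1≡ : ∀ d → 2 ℕ.* suc d ∸ 1 ≡ d ℕ.+ suc d
2[1+d]∸1≡ d = cong (d ℕ.+_) (ℕ.+-identityʳ (suc d))

lightest-ratio : ∀ d → (2 ℕ.* suc d ∸ 1) ℕ.* suc d ℕ.< suc d ℕ.* (suc d ℕ.+ suc d)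
lightest-ratio d rewrite 2[1+d]∸1≡ d =
  subst ((d ℕ.+ suc d) ℕ.* suc d ℕ.<_) (sym (gap d)) (ℕ.m<m+n _ (ℕ.s≤s ℕ.z≤n))
  where
  gap : ∀ d → suc d ℕ.* (suc d ℕ.+ suc d) ≡ (d ℕ.+ suc d) ℕ.* suc d ℕ.+ suc d
  gap = solve-∀

adjacent-ratio : ∀ d i → let y = i ℕ.+ suc d in (2 ℕ.* suc d ∸ 1) ℕ.* suc y ℕ.< suc d ℕ.* (y ℕ.+ suc y)
adjacent-ratio d i rewrite 2[1+d]∸1≡ d =
  subst ((d ℕ.+ suc d) ℕ.* suc (i ℕ.+ suc d) ℕ.<_) (sym (gap d i)) (ℕ.m<m+n _ (ℕ.s≤s ℕ.z≤n))
  where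
  gap : ∀ d i → suc d ℕ.* ((i ℕ.+ suc d) ℕ.+ suc (i ℕ.+ suc d)) ≡ (d ℕ.+ suc d) ℕ.* suc (i ℕ.+ suc d) ℕ.+ suc i
  gap = solve-∀

theorem4 : (A : Memoryless) (R : ℚ) → R < 1ℚ + 1ℚ → ¬ Competitive R A
theorem4 A R R<2 = cases (A L) refl
  where
  d = ℚ.denominator-1 R
  m = suc d
  L = map fromℕ (ladder m (suc m))
  cases : (choice : Maybe (Fin (length L))) → A L ≡ choice → ¬ Competitive R A
  cases nothing  idle = ¬Competitive-idle A R d (ladder (suc m) m) idle
  cases (just j) eq with toℕ j in index
  ... | zero  = ¬Competitive-oneShot A R R<2 [] m (ladder (suc m) m) (ladder m m) (m ℕ.+ m) []
                  (trans (cong (ladder m) (ℕ.+-comm 1 m)) (ladder-+ m m 1)) (j , eq , index) (lightest-ratio d)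
  ... | suc i with ladder-split m (suc m) i (subst (ℕ._< suc m) index (toℕ<length-ladder m (suc m) j))
  ...   | l′ , split = ¬Competitive-repeated A R R<2 (ladder m i) (i ℕ.+ m) (suc (i ℕ.+ m)) (ladder _ l′)
                         (subst₂ (λ ws k → Picks (A (map fromℕ ws)) k) split (cong suc (sym (length-ladder m i)))
                                 (j , eq , index))
                         (adjacent-ratio d i)
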